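{- Let $k\ge 4$ and $n\ge 9$ be integers with $k\le (n-1)/2$, and let $\mathbf{e}_k\in\mathbb{F}_2^n$ be the sequence with a $1$ in position $k$ (positions numbered $0,\ldots,n-1$) and $0$ elsewhere. Then $|T(\mathbf{e}_k)|\ge 2n-3$; moreover, if $n$ is even, $|T(\mathbf{e}_k)|>2n-3$.
   Context: For $\mathbf{x}=(x_0,\ldots,x_{n-1})\in\mathbb{F}_2^n$, the derivative is $\partial\mathbf{x}=(x_0+x_1,\ldots,x_{n-2}+x_{n-1})\in\mathbb{F}_2^{n-1}$, with $\partial^0\mathbf{x}=\mathbf{x}$ and $\partial^i\mathbf{x}=\partial(\partial^{i-1}\mathbf{x})$. The Steinhaus triangle is $T(\mathbf{x})=(\mathbf{x},\partial\mathbf{x},\ldots,\partial^{n-1}\mathbf{x})$; $|\mathbf{y}|$ is the number of ones of a binary sequence and $|T(\mathbf{x})|=\sum_{i=0}^{n-1}|\partial^i\mathbf{x}|$. -}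

module Defs where

open import Data.Bool using (Bool; true; false; _xor_)
open import Data.Nat using (ℕ; zero; suc; _+_; _≡ᵇ_)
open import Data.List using (List; []; _∷_; length; map; upTo; applyUpTo)
open import Data.Nat.ListAction using (sum)

-- Binary sequences over F₂ are lists of Booleans (true = 1, false = 0).

∂ : List Bool → List Bool
∂ []           = []
∂ (x ∷ [])     = []
∂ (x ∷ y ∷ xs) = (x xor y) ∷ ∂ (y ∷ xs)

∂^ : ℕ → List Bool → List Bool
∂^ zero    x = x
∂^ (suc i) x = ∂ (∂^ i x)

weight : List Bool → ℕ
weight []           = 0
weight (true ∷ ys)  = suc (weight ys)
weight (false ∷ ys) = weight ys

steinhaus : List Bool → List (List Bool)
steinhaus x = map (λ i → ∂^ i x) (upTo (length x))

triangleWeight : List Bool → ℕ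
triangleWeight x = sum (map weight (steinhaus x))

e : ℕ → ℕ → List Bool
e n k = applyUpTo (λ i → i ≡ᵇ k) n

-- Entry j of ∂^i e_k is C(i, k - j) mod 2, so |T(e_k)| counts the odd C(t + s, t) in the rectangle
-- t ≤ k, s ≤ b, where b = n - k - 1. The rows t < 4 of Pascal's triangle mod 2 have period 4 with 9 odd
-- entries per period, and by symmetry the same holds for the columns s < 4. Writing F c for the number of odd
-- entries in the first c columns of rows 0 to 3, the two bands give |T(e_k)| ≥ 9 + F (b - 3) + F (k - 3).
-- Since F c ≥ 2c + 1 for c ≥ 1, with equality only at c = 4, this is at least 2n - 3, and strictly more
-- unless k = b = 7, i.e. n = 15.

module Submission where

open import Defs
open import Data.Nat using (ℕ; _+_; _*_; _∸_; _≤_; _<_)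
open import Data.Nat.Divisibility using (_∣_)
open import Data.Product using (_×_)

open import Data.Bool using (Bool; true; false; _xor_)
open import Data.Bool.Properties using (xor-comm; xor-identityʳ)
open import Data.Empty using (⊥-elim)
open import Data.List using (List; []; _∷_; length; drop; map; upTo; applyUpTo)
open import Data.List.Properties using (map-upTo; map-applyUpTo; length-applyUpTo)
open import Data.Nat using (zero; suc; pred; z≤n; s≤s; s≤s⁻¹; z<s; s<s; _≡ᵇ_)
open import Data.Nat.Divisibility using (_∣?_)
open import Data.Nat.ListAction using (sum)
open import Data.Nat.Properties
open import Algebra.Properties.CommutativeSemigroup +-commutativeSemigroup using () renaming (interchange to +-interchange)
open import Data.Nat.Tactic.RingSolver using (solve-∀)
open import Data.Product using (∃₂; _,_)
open import Relation.Binary.PropositionalEquality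
open import Relation.Nullary using (yes; no)
open import Relation.Nullary.Decidable using (from-no)

∑ : (ℕ → ℕ) → ℕ → ℕ
∑ f m = sum (applyUpTo f m)

syntax ∑ (λ i → x) m = ∑[ i < m ] x

∑-cong : ∀ {f g} m → (∀ i → i < m → f i ≡ g i) → ∑ f m ≡ ∑ g m
∑-cong zero    f≡g = refl
∑-cong (suc m) f≡g = cong₂ _+_ (f≡g 0 z<s) (∑-cong m (λ i i<m → f≡g (suc i) (s<s i<m)))

∑-zero : ∀ {f} m → (∀ i → i < m → f i ≡ 0) → ∑ f m ≡ 0
∑-zero zero    f≡0 = refl
∑-zero (suc m) f≡0 = cong₂ _+_ (f≡0 0 z<s) (∑-zero m (λ i i<m → f≡0 (suc i) (s<s i<m)))

∑-mono-≤ : ∀ {f g} m → (∀ i → f i ≤ g i) → ∑ f m ≤ ∑ g m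
∑-mono-≤ zero    f≤g = z≤n
∑-mono-≤ (suc m) f≤g = +-mono-≤ (f≤g 0) (∑-mono-≤ m (λ i → f≤g (suc i)))

∑-monoʳ-≤ : ∀ f {p q} → p ≤ q → ∑ f p ≤ ∑ f q
∑-monoʳ-≤ f z≤n       = z≤n
∑-monoʳ-≤ f (s≤s p≤q) = +-monoʳ-≤ (f 0) (∑-monoʳ-≤ (λ i → f (suc i)) p≤q)

∑-distrib-+ : ∀ f g m → ∑[ i < m ] (f i + g i) ≡ ∑ f m + ∑ g m
∑-distrib-+ f g zero    = refl
∑-distrib-+ f g (suc m) = begin
  f 0 + g 0 + ∑[ i < m ] (f (suc i) + g (suc i))
    ≡⟨ cong (f 0 + g 0 +_) (∑-distrib-+ (λ i → f (suc i)) (λ i → g (suc i)) m) ⟩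
  f 0 + g 0 + (∑[ i < m ] f (suc i) + ∑[ i < m ] g (suc i))
    ≡⟨ +-interchange (f 0) (g 0) _ _ ⟩
  ∑ f (suc m) + ∑ g (suc m) ∎
  where open ≡-Reasoning

∑-split : ∀ f p q → ∑ f (p + q) ≡ ∑ f p + ∑[ i < q ] f (p + i)
∑-split f zero    q = refl
∑-split f (suc p) q =
  trans (cong (f 0 +_) (∑-split (λ i → f (suc i)) p q)) (sym (+-assoc (f 0) _ _))

∑-snoc : ∀ f m → ∑ f (suc m) ≡ ∑ f m + f m
∑-snoc f m = begin
  ∑ f (suc m)                ≡⟨ cong (∑ f) (+-comm 1 m) ⟩
  ∑ f (m + 1)                ≡⟨ ∑-split f m 1 ⟩
  ∑ f m + (f (m + 0) + 0)    ≡⟨ cong (λ j → ∑ f m + (f j + 0)) (+-identityʳ m) ⟩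
  ∑ f m + (f m + 0)          ≡⟨ cong (∑ f m +_) (+-identityʳ (f m)) ⟩
  ∑ f m + f m                ∎
  where open ≡-Reasoning

∑-comm : ∀ (h : ℕ → ℕ → ℕ) p q → ∑[ i < p ] ∑[ j < q ] h i j ≡ ∑[ j < q ] ∑[ i < p ] h i j
∑-comm h zero    q = sym (∑-zero q (λ _ _ → refl))
∑-comm h (suc p) q = trans (cong (∑[ j < q ] h 0 j +_) (∑-comm (λ i → h (suc i)) p q))
                           (sym (∑-distrib-+ (h 0) (λ j → ∑[ i < p ] h (suc i) j) q))

bit : Bool → ℕ
bit true  = 1
bit false = 0

leading : List Bool → Bool
leading []      = false
leading (x ∷ _) = x

weight-leading : ∀ x → weight x ≡ bit (leading x) + weight (drop 1 x)
weight-leading []          = refl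
weight-leading (true ∷ x)  = refl
weight-leading (false ∷ x) = refl

length-∂ : ∀ x → length (∂ x) ≡ pred (length x)
length-∂ []          = refl
length-∂ (x ∷ [])     = refl
length-∂ (x ∷ y ∷ xs) = cong suc (length-∂ (y ∷ xs))

length-∂^ : ∀ i x → length (∂^ i x) ≡ length x ∸ i
length-∂^ zero    x = refl
length-∂^ (suc i) x = begin
  length (∂ (∂^ i x))      ≡⟨ length-∂ (∂^ i x) ⟩
  pred (length (∂^ i x))   ≡⟨ cong pred (length-∂^ i x) ⟩
  pred (length x ∸ i)      ≡⟨ pred[m∸n]≡m∸[1+n] (length x) i ⟩
  length x ∸ suc i         ∎
  where open ≡-Reasoning

∂-drop : ∀ x → ∂ (drop 1 x) ≡ drop 1 (∂ x)
∂-drop []          = refl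
∂-drop (x ∷ [])     = refl
∂-drop (x ∷ y ∷ xs) = refl

∂^-drop : ∀ i x → ∂^ i (drop 1 x) ≡ drop 1 (∂^ i x)
∂^-drop zero    x = refl
∂^-drop (suc i) x = trans (cong ∂ (∂^-drop i x)) (∂-drop (∂^ i x))

leading-∂ : ∀ x → 2 ≤ length x → leading (∂ x) ≡ leading x xor leading (drop 1 x)
leading-∂ (x ∷ [])     (s≤s ())
leading-∂ (x ∷ y ∷ xs) _ = refl

-- Hence the left edge of T(x) is the binomial transform of x.
leading-∂^-suc : ∀ i x → suc i < length x →
  leading (∂^ (suc i) x) ≡ leading (∂^ i x) xor leading (∂^ i (drop 1 x))
leading-∂^-suc i x i+1<len = begin
  leading (∂ (∂^ i x))                                ≡⟨ leading-∂ (∂^ i x) 2≤len ⟩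
  leading (∂^ i x) xor leading (drop 1 (∂^ i x))      ≡⟨ cong (λ y → leading (∂^ i x) xor leading y) (∂^-drop i x) ⟨
  leading (∂^ i x) xor leading (∂^ i (drop 1 x))      ∎
  where
  open ≡-Reasoning
  2≤len : 2 ≤ length (∂^ i x)
  2≤len = subst (2 ≤_) (sym (length-∂^ i x)) (m+n≤o⇒m≤o∸n 2 i+1<len)

triangleWeight-∑ : ∀ x → triangleWeight x ≡ ∑[ i < length x ] weight (∂^ i x)
triangleWeight-∑ x = begin
  sum (map weight (map (λ i → ∂^ i x) (upTo (length x))))
    ≡⟨ cong (λ l → sum (map weight l)) (map-upTo (λ i → ∂^ i x) (length x)) ⟩
  sum (map weight (applyUpTo (λ i → ∂^ i x) (length x)))
    ≡⟨ cong sum (map-applyUpTo (λ i → ∂^ i x) weight (length x)) ⟩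
  ∑[ i < length x ] weight (∂^ i x) ∎
  where open ≡-Reasoning

edgeWeight : List Bool → ℕ
edgeWeight x = ∑[ i < length x ] bit (leading (∂^ i x))

triangleWeight-∷ : ∀ y x → triangleWeight (y ∷ x) ≡ edgeWeight (y ∷ x) + triangleWeight x
triangleWeight-∷ y x = begin
  triangleWeight (y ∷ x)
    ≡⟨ triangleWeight-∑ (y ∷ x) ⟩
  ∑[ i < suc m ] weight (∂^ i (y ∷ x))
    ≡⟨ ∑-cong (suc m) (λ i _ → trans (weight-leading (∂^ i (y ∷ x)))
                                      (cong (λ z → bit (leading (∂^ i (y ∷ x))) + weight z) (sym (∂^-drop i (y ∷ x))))) ⟩
  ∑[ i < suc m ] (bit (leading (∂^ i (y ∷ x))) + weight (∂^ i x))
    ≡⟨ ∑-distrib-+ (λ i → bit (leading (∂^ i (y ∷ x)))) (λ i → weight (∂^ i x)) (suc m) ⟩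
  edgeWeight (y ∷ x) + ∑[ i < suc m ] weight (∂^ i x)
    ≡⟨ cong (edgeWeight (y ∷ x) +_) (∑-snoc _ m) ⟩
  edgeWeight (y ∷ x) + (∑[ i < m ] weight (∂^ i x) + weight (∂^ m x))
    ≡⟨ cong (λ w → edgeWeight (y ∷ x) + (w + weight (∂^ m x))) (triangleWeight-∑ x) ⟨
  edgeWeight (y ∷ x) + (triangleWeight x + weight (∂^ m x))
    ≡⟨ cong (λ w → edgeWeight (y ∷ x) + (triangleWeight x + w)) (weight-empty (∂^ m x) (trans (length-∂^ m x) (n∸n≡0 m))) ⟩
  edgeWeight (y ∷ x) + (triangleWeight x + 0)
    ≡⟨ cong (edgeWeight (y ∷ x) +_) (+-identityʳ (triangleWeight x)) ⟩
  edgeWeight (y ∷ x) + triangleWeight x ∎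
  where
  open ≡-Reasoning
  m = length x
  weight-empty : ∀ z → length z ≡ 0 → weight z ≡ 0
  weight-empty [] _ = refl

zeros : ℕ → List Bool
zeros n = applyUpTo (λ _ → false) n

∂-zeros : ∀ n → ∂ (zeros n) ≡ zeros (pred n)
∂-zeros zero          = refl
∂-zeros (suc zero)    = refl
∂-zeros (suc (suc n)) = cong (false ∷_) (∂-zeros (suc n))

∂^-zeros : ∀ i n → ∂^ i (zeros n) ≡ zeros (n ∸ i)
∂^-zeros zero    n = refl
∂^-zeros (suc i) n = trans (cong ∂ (∂^-zeros i n))
                           (trans (∂-zeros (n ∸ i)) (cong zeros (pred[m∸n]≡m∸[1+n] n i)))

leading-zeros : ∀ n → leading (zeros n) ≡ false
leading-zeros zero    = refl
leading-zeros (suc n) = refl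

weight-zeros : ∀ n → weight (zeros n) ≡ 0
weight-zeros zero    = refl
weight-zeros (suc n) = weight-zeros n

triangleWeight-zeros : ∀ n → triangleWeight (zeros n) ≡ 0
triangleWeight-zeros n = trans (triangleWeight-∑ (zeros n))
  (∑-zero (length (zeros n)) (λ i _ → trans (cong weight (∂^-zeros i n)) (weight-zeros (n ∸ i))))

binom₂ : ℕ → ℕ → Bool
binom₂ zero    zero    = true
binom₂ zero    (suc t) = false
binom₂ (suc i) zero    = binom₂ i zero
binom₂ (suc i) (suc t) = binom₂ i (suc t) xor binom₂ i t

-- pascal₂ t s is the parity of C(t + s, t), indexed symmetrically.
pascal₂ : ℕ → ℕ → Bool
pascal₂ zero    s       = true
pascal₂ (suc t) zero    = true
pascal₂ (suc t) (suc s) = pascal₂ t (suc s) xor pascal₂ (suc t) s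

binom₂-below : ∀ i t → i < t → binom₂ i t ≡ false
binom₂-below zero    (suc t) _         = refl
binom₂-below (suc i) (suc t) (s≤s i<t) =
  cong₂ _xor_ (binom₂-below i (suc t) (m<n⇒m<1+n i<t)) (binom₂-below i t i<t)

binom₂-zeroʳ : ∀ i → binom₂ i 0 ≡ true
binom₂-zeroʳ zero    = refl
binom₂-zeroʳ (suc i) = binom₂-zeroʳ i

binom₂-diagonal : ∀ t → binom₂ t t ≡ true
binom₂-diagonal zero    = refl
binom₂-diagonal (suc t) = cong₂ _xor_ (binom₂-below t (suc t) (n<1+n t)) (binom₂-diagonal t)

binom₂-pascal₂ : ∀ t s → binom₂ (t + s) t ≡ pascal₂ t s
binom₂-pascal₂ zero    s    = binom₂-zeroʳ s
binom₂-pascal₂ (suc t) zero = trans (cong (λ i → binom₂ i (suc t)) (+-identityʳ (suc t))) (binom₂-diagonal (suc t))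
binom₂-pascal₂ (suc t) (suc s) = begin
  binom₂ (suc t + suc s) (suc t)
    ≡⟨ cong (λ i → binom₂ i (suc t)) (+-suc (suc t) s) ⟩
  binom₂ (suc t + s) (suc t) xor binom₂ (suc t + s) t
    ≡⟨ cong (λ i → binom₂ (suc t + s) (suc t) xor binom₂ i t) (sym (+-suc t s)) ⟩
  binom₂ (suc t + s) (suc t) xor binom₂ (t + suc s) t
    ≡⟨ cong₂ _xor_ (binom₂-pascal₂ (suc t) s) (binom₂-pascal₂ t (suc s)) ⟩
  pascal₂ (suc t) s xor pascal₂ t (suc s)
    ≡⟨ xor-comm (pascal₂ (suc t) s) (pascal₂ t (suc s)) ⟩
  pascal₂ (suc t) (suc s) ∎
  where open ≡-Reasoning

pascal₂-comm : ∀ t s → pascal₂ t s ≡ pascal₂ s t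
pascal₂-comm zero    zero    = refl
pascal₂-comm zero    (suc s) = refl
pascal₂-comm (suc t) zero    = refl
pascal₂-comm (suc t) (suc s) =
  trans (cong₂ _xor_ (pascal₂-comm t (suc s)) (pascal₂-comm (suc t) s))
        (xor-comm (pascal₂ (suc s) t) (pascal₂ s (suc t)))

-- The induction starts from C(4 + u, u) being odd for u < 4.
pascal₂-periodic : ∀ u s → u < 4 → pascal₂ u (4 + s) ≡ pascal₂ u s
pascal₂-periodic 0 s       _ = refl
pascal₂-periodic 1 zero    _ = refl
pascal₂-periodic 2 zero    _ = refl
pascal₂-periodic 3 zero    _ = refl
pascal₂-periodic (suc (suc (suc (suc _)))) zero (s≤s (s≤s (s≤s (s≤s ()))))
pascal₂-periodic (suc u) (suc s) u<4 =
  cong₂ _xor_ (pascal₂-periodic u (suc s) (m<n⇒m<1+n (s≤s⁻¹ u<4))) (pascal₂-periodic (suc u) s u<4)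

leading-∂^-e : ∀ i n k → i < n → leading (∂^ i (e n k)) ≡ binom₂ i k
leading-∂^-e zero    (suc n) zero    _ = refl
leading-∂^-e zero    (suc n) (suc k) _ = refl
leading-∂^-e (suc i) (suc n) k i+1<n =
  trans (leading-∂^-suc i (e (suc n) k) (subst (suc i <_) (sym (length-applyUpTo (λ j → j ≡ᵇ k) (suc n))) i+1<n))
        (tail-step k)
  where
  i<n : i < suc n
  i<n = m<n⇒m<1+n (s≤s⁻¹ i+1<n)
  tail-step : ∀ k → leading (∂^ i (e (suc n) k)) xor leading (∂^ i (drop 1 (e (suc n) k))) ≡ binom₂ (suc i) k
  tail-step zero = begin
    leading (∂^ i (e (suc n) 0)) xor leading (∂^ i (zeros n))
      ≡⟨ cong₂ _xor_ (leading-∂^-e i (suc n) 0 i<n) (trans (cong leading (∂^-zeros i n)) (leading-zeros (n ∸ i))) ⟩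
    binom₂ i 0 xor false
      ≡⟨ xor-identityʳ (binom₂ i 0) ⟩
    binom₂ i 0 ∎
    where open ≡-Reasoning
  tail-step (suc k) = cong₂ _xor_ (leading-∂^-e i (suc n) (suc k) i<n) (leading-∂^-e i n k (s≤s⁻¹ i+1<n))

oddBinomials : ℕ → ℕ → ℕ
oddBinomials r c = ∑[ t < r ] ∑[ s < c ] bit (pascal₂ t s)

edgeWeight-e : ∀ k b → edgeWeight (e (suc (k + b)) k) ≡ ∑[ s < suc b ] bit (pascal₂ k s)
edgeWeight-e k b = begin
  ∑[ i < length (e n k) ] bit (leading (∂^ i (e n k)))
    ≡⟨ cong (λ m → ∑[ i < m ] bit (leading (∂^ i (e n k)))) (length-applyUpTo (λ j → j ≡ᵇ k) n) ⟩
  ∑[ i < n ] bit (leading (∂^ i (e n k)))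
    ≡⟨ ∑-cong n (λ i i<n → cong bit (leading-∂^-e i n k i<n)) ⟩
  ∑[ i < suc (k + b) ] bit (binom₂ i k)
    ≡⟨ cong (∑ (λ i → bit (binom₂ i k))) (+-suc k b) ⟨
  ∑[ i < k + suc b ] bit (binom₂ i k)
    ≡⟨ ∑-split (λ i → bit (binom₂ i k)) k (suc b) ⟩
  ∑[ i < k ] bit (binom₂ i k) + ∑[ s < suc b ] bit (binom₂ (k + s) k)
    ≡⟨ cong₂ _+_ (∑-zero k (λ i i<k → cong bit (binom₂-below i k i<k)))
                 (∑-cong (suc b) (λ s _ → cong bit (binom₂-pascal₂ k s))) ⟩
  ∑[ s < suc b ] bit (pascal₂ k s) ∎
  where
  open ≡-Reasoning
  n = suc (k + b)

triangleWeight-e : ∀ k b → triangleWeight (e (suc (k + b)) k) ≡ oddBinomials (suc k) (suc b)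
triangleWeight-e zero b =
  trans (triangleWeight-∷ true (zeros b)) (cong₂ _+_ (edgeWeight-e 0 b) (triangleWeight-zeros b))
triangleWeight-e (suc k) b = begin
  triangleWeight (false ∷ e (suc (k + b)) k)
    ≡⟨ triangleWeight-∷ false (e (suc (k + b)) k) ⟩
  edgeWeight (e (suc (suc k + b)) (suc k)) + triangleWeight (e (suc (k + b)) k)
    ≡⟨ cong₂ _+_ (edgeWeight-e (suc k) b) (triangleWeight-e k b) ⟩
  row (suc k) + oddBinomials (suc k) (suc b)
    ≡⟨ +-comm (row (suc k)) _ ⟩
  oddBinomials (suc k) (suc b) + row (suc k)
    ≡⟨ ∑-snoc row (suc k) ⟨
  oddBinomials (suc (suc k)) (suc b) ∎
  where
  open ≡-Reasoning
  row : ℕ → ℕ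
  row t = ∑[ s < suc b ] bit (pascal₂ t s)

oddBinomials-4-+4 : ∀ c → oddBinomials 4 (4 + c) ≡ 9 + oddBinomials 4 c
oddBinomials-4-+4 c = begin
  ∑[ t < 4 ] ∑[ s < 4 + c ] bit (pascal₂ t s)
    ≡⟨ ∑-cong 4 (λ t t<4 → trans (∑-split (λ s → bit (pascal₂ t s)) 4 c)
         (cong (∑[ s < 4 ] bit (pascal₂ t s) +_) (∑-cong c (λ s _ → cong bit (pascal₂-periodic t s t<4))))) ⟩
  ∑[ t < 4 ] (∑[ s < 4 ] bit (pascal₂ t s) + ∑[ s < c ] bit (pascal₂ t s))
    ≡⟨ ∑-distrib-+ (λ t → ∑[ s < 4 ] bit (pascal₂ t s)) (λ t → ∑[ s < c ] bit (pascal₂ t s)) 4 ⟩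
  9 + oddBinomials 4 c ∎
  where open ≡-Reasoning

-- By symmetry and periodicity, the block of rows ≥ 4 and columns < 4 contains a copy of the 4 × r band.
oddBinomials-lower : ∀ r c → 9 + oddBinomials 4 c + oddBinomials 4 r ≤ oddBinomials (4 + r) (4 + c)
oddBinomials-lower r c = begin
  9 + oddBinomials 4 c + oddBinomials 4 r
    ≡⟨ cong₂ _+_ (oddBinomials-4-+4 c) (sym lowerBlock) ⟨
  oddBinomials 4 (4 + c) + ∑[ t < r ] ∑[ s < 4 ] bit (pascal₂ (4 + t) s)
    ≤⟨ +-monoʳ-≤ _ (∑-mono-≤ r (λ t → ∑-monoʳ-≤ (λ s → bit (pascal₂ (4 + t) s)) (m≤m+n 4 c))) ⟩
  oddBinomials 4 (4 + c) + ∑[ t < r ] ∑[ s < 4 + c ] bit (pascal₂ (4 + t) s)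
    ≡⟨ ∑-split (λ t → ∑[ s < 4 + c ] bit (pascal₂ t s)) 4 r ⟨
  oddBinomials (4 + r) (4 + c) ∎
  where
  open ≤-Reasoning
  lowerBlock : oddBinomials 4 r ≡ ∑[ t < r ] ∑[ s < 4 ] bit (pascal₂ (4 + t) s)
  lowerBlock = trans
    (∑-cong 4 (λ s s<4 → ∑-cong r (λ t _ →
      cong bit (trans (sym (pascal₂-periodic s t s<4)) (pascal₂-comm s (4 + t))))))
    (∑-comm (λ s t → bit (pascal₂ (4 + t) s)) 4 r)

oddBinomials-4-lower : ∀ c → 1 + 2 * suc c ≤ oddBinomials 4 (suc c)
oddBinomials-4-lower-+4 : ∀ c → 2 + 2 * (5 + c) ≤ oddBinomials 4 (5 + c)

oddBinomials-4-lower 0 = ≤ᵇ⇒≤ _ _ _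
oddBinomials-4-lower 1 = ≤ᵇ⇒≤ _ _ _
oddBinomials-4-lower 2 = ≤ᵇ⇒≤ _ _ _
oddBinomials-4-lower 3 = ≤ᵇ⇒≤ _ _ _
oddBinomials-4-lower (suc (suc (suc (suc c)))) = <⇒≤ (oddBinomials-4-lower-+4 c)

oddBinomials-4-lower-+4 c = begin
  2 + 2 * (5 + c)            ≡⟨ shape c ⟩
  9 + (1 + 2 * suc c)        ≤⟨ +-monoʳ-≤ 9 (oddBinomials-4-lower c) ⟩
  9 + oddBinomials 4 (suc c) ≡⟨ oddBinomials-4-+4 (suc c) ⟨
  oddBinomials 4 (5 + c)     ∎
  where
  open ≤-Reasoning
  shape : ∀ c → 2 + 2 * (5 + c) ≡ 9 + (1 + 2 * (1 + c))
  shape = solve-∀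

oddBinomials-4-lower-strict : ∀ c → c ≢ 3 → 2 + 2 * suc c ≤ oddBinomials 4 (suc c)
oddBinomials-4-lower-strict 0 _ = ≤ᵇ⇒≤ _ _ _
oddBinomials-4-lower-strict 1 _ = ≤ᵇ⇒≤ _ _ _
oddBinomials-4-lower-strict 2 _ = ≤ᵇ⇒≤ _ _ _
oddBinomials-4-lower-strict 3 c≢3 = ⊥-elim (c≢3 refl)
oddBinomials-4-lower-strict (suc (suc (suc (suc c)))) _ = oddBinomials-4-lower-+4 c

split-4≤k≤n∸k : ∀ {k n} → 4 ≤ k → 2 * k ≤ n → ∃₂ λ a d → k ≡ 4 + a × n ≡ k + (4 + d)
split-4≤k≤n∸k {k} 4≤k 2k≤n
  with m≤n⇒∃[o]m+o≡n 4≤k | m≤n⇒∃[o]m+o≡n (≤-trans (+-monoʳ-≤ k (≤-trans 4≤k (m≤m+n k 0))) 2k≤n)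
... | a , 4+a≡k | d , k+4+d≡n = a , d , sym 4+a≡k , trans (sym k+4+d≡n) (+-assoc k 4 d)

proposition3p3 : (k n : ℕ) → 4 ≤ k → 9 ≤ n → 2 * k ≤ n ∸ 1 →
    (2 * n ∸ 3 ≤ triangleWeight (e n k)) × (2 ∣ n → 2 * n ∸ 3 < triangleWeight (e n k))
proposition3p3 k (suc n) 4≤k _ 2k≤n with split-4≤k≤n∸k 4≤k 2k≤n
... | a , d , refl , refl = weak , strict
  where
  N = suc ((4 + a) + (4 + d))
  T = triangleWeight (e N (4 + a))
  lower = 9 + (1 + 2 * suc d) + (1 + 2 * suc a)

  2N∸3≡lower : 2 * N ∸ 3 ≡ lower
  2N∸3≡lower = trans (cong (_∸ 3) (shape a d)) (m+n∸m≡n 3 lower)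
    where
    shape : ∀ a d → 2 * suc ((4 + a) + (4 + d)) ≡ 3 + (9 + (1 + 2 * suc d) + (1 + 2 * suc a))
    shape = solve-∀

  bands : ∀ {x y} → x ≤ oddBinomials 4 (suc d) → y ≤ oddBinomials 4 (suc a) → 9 + x + y ≤ T
  bands x≤ y≤ = ≤-trans (+-mono-≤ (+-monoʳ-≤ 9 x≤) y≤)
    (≤-trans (oddBinomials-lower (suc a) (suc d)) (≤-reflexive (sym (triangleWeight-e (4 + a) (4 + d)))))

  weak : 2 * N ∸ 3 ≤ T
  weak = ≤-trans (≤-reflexive 2N∸3≡lower) (bands (oddBinomials-4-lower d) (oddBinomials-4-lower a))

  -- a = d = 3 means k = 7 and n = 15.
  strict : 2 ∣ N → 2 * N ∸ 3 < T
  strict 2∣N with a ≟ 3 | d ≟ 3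
  ... | yes a≡3 | yes d≡3 = ⊥-elim (from-no (2 ∣? 15) (subst₂ (λ a d → 2 ∣ suc ((4 + a) + (4 + d))) a≡3 d≡3 2∣N))
  ... | no a≢3  | _       = ≤-trans (s≤s (≤-reflexive 2N∸3≡lower))
    (≤-trans (≤-reflexive (sym (+-suc (9 + (1 + 2 * suc d)) (1 + 2 * suc a))))
             (bands (oddBinomials-4-lower d) (oddBinomials-4-lower-strict a a≢3)))
  ... | yes _   | no d≢3  = ≤-trans (s≤s (≤-reflexive 2N∸3≡lower))
    (bands (oddBinomials-4-lower-strict d d≢3) (oddBinomials-4-lower a))
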